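{- Let $E_1,E_2$ be propositional variables and $\delta$ a new atomic formula symbol. Write $\veebar$ for exclusive disjunction. Then $\mathsf{QLP}(\delta\leftrightarrow[E_1\wedge\neg(\exists x)x:(\delta\rightarrow E_1)]\veebar[E_2\wedge\neg(\exists x)x:(\delta\wedge\neg E_1\rightarrow E_2)])_{\emptyset}\vdash\neg\delta$, where this logic is $\mathsf{QLP}$ without Axiom Necessitation, over the language extended by $\delta$, with that single additional axiom.
   Context: Fix countably many justification variables, propositional variables, and primitive function symbols of each arity $n\ge0$; a primitive term is $f(x_1,\dots,x_n)$. Terms of $\mathsf{QLP}$: $t::= x\mid f(x_1,\dots,x_n)\mid t\cdot t\mid t+t\mid !t\mid(t\forall x)$ ($x$ bound in $(t\forall x)$). Formulas: $A::= p\mid\bot\mid\neg A\mid A\wedge A\mid A\vee A\mid A\rightarrow A\mid t:A\mid(\forall x)A\mid(\exists x)A$. Axioms: all propositional tautologies; Q1: $(\forall x)A(x)\rightarrow A(t)$, $t$ free for $x$; Q2: $(\forall x)(A\rightarrow B(x))\rightarrow(A\rightarrow(\forall x)B(x))$, $x$ not free in $A$; Q3: $A(t)\rightarrow(\exists x)A(x)$, $t$ free for $x$; Q4: $(\forall x)(A(x)\rightarrow B)\rightarrow((\exists x)A(x)\rightarrow B)$, $x$ not free in $B$; jK: $s:(A\rightarrow B)\rightarrow(t:A\rightarrow(s\cdot t):B)$; jT: $t:A\rightarrow A$; j4: $t:A\rightarrow !t:t:A$; Sum: $s:A\rightarrow(s+t):A$, $s:A\rightarrow(t+s):A$; UF: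 $(\exists y)y:(\forall x)t:A\rightarrow(t\forall x):(\forall x)A$, $y$ not free in $t$ or $A$. Rules: Modus Ponens; Gen: from $A$ infer $(\forall x)A$; qNec: from $A$ infer $(\exists x)x:A$, $x$ not free in $A$; Axiom Necessitation: from an axiom instance $A$ infer $f(x_1,\dots,x_n):A$. The subscript $\emptyset$ means Axiom Necessitation is dropped. All schemes and rules apply to formulas of the extended language. -}

module Defs where

open import Data.Nat using (ℕ; _≡ᵇ_)
open import Data.Bool using (Bool; true; false; T; not; if_then_else_)
  renaming (_∧_ to _and_; _∨_ to _or_)
open import Data.Vec using (Vec)
import Data.Vec as V
open import Data.Maybe using (Maybe; just; nothing)
import Data.Maybe as M
open import Relation.Binary.PropositionalEquality using (_≡_)

data Tm : Set where
  var   : ℕ → Tm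
  fn    : (n k : ℕ) → Vec ℕ n → Tm        -- primitive term f_k^n(x_1,…,x_n)
  _·_   : Tm → Tm → Tm
  _⊕_   : Tm → Tm → Tm
  !_    : Tm → Tm
  _∀ʲ_  : Tm → ℕ → Tm                     -- (t ∀ x), x bound

data Fm : Set where
  atom : ℕ → Fm
  δ    : Fm
  ⊥'   : Fm
  ~_   : Fm → Fm
  _⋀_  : Fm → Fm → Fm
  _⋁_  : Fm → Fm → Fm
  _⇒_  : Fm → Fm → Fm
  _∶_  : Tm → Fm → Fm
  ∀'   : ℕ → Fm → Fm
  ∃'   : ℕ → Fm → Fm

infixr 4 _⇒_
infixr 5 _⋁_
infixr 6 _⋀_
infix  7 _∶_
infix  8 ~_

_⇔_ : Fm → Fm → Fm
A ⇔ B = (A ⇒ B) ⋀ (B ⇒ A)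

_⊻_ : Fm → Fm → Fm
A ⊻ B = (A ⋁ B) ⋀ ~ (A ⋀ B)

memb : ∀ {n} → ℕ → Vec ℕ n → Bool
memb x V.[] = false
memb x (y V.∷ ys) = (x ≡ᵇ y) or memb x ys

freeT : ℕ → Tm → Bool
freeT x (var y) = x ≡ᵇ y
freeT x (fn n k xs) = memb x xs
freeT x (t · s) = freeT x t or freeT x s
freeT x (t ⊕ s) = freeT x t or freeT x s
freeT x (! t) = freeT x t
freeT x (t ∀ʲ y) = not (x ≡ᵇ y) and freeT x t

freeF : ℕ → Fm → Bool
freeF x (atom p) = false
freeF x δ = false
freeF x ⊥' = false
freeF x (~ A) = freeF x A
freeF x (A ⋀ B) = freeF x A or freeF x B
freeF x (A ⋁ B) = freeF x A or freeF x B
freeF x (A ⇒ B) = freeF x A or freeF x B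
freeF x (t ∶ A) = freeT x t or freeF x A
freeF x (∀' y A) = not (x ≡ᵇ y) and freeF x A
freeF x (∃' y A) = not (x ≡ᵇ y) and freeF x A

-- Primitive terms f(x_1,…,x_n) only take variables, so substituting a
-- non-variable term for a variable occurring in a primitive term does not
-- yield a term of the language: the substitution is then undefined (nothing).

renameV : ∀ {n} → ℕ → ℕ → Vec ℕ n → Vec ℕ n
renameV x z = V.map (λ y → if x ≡ᵇ y then z else y)

substT : ℕ → Tm → Tm → Maybe Tm
substT x s (var y) = if x ≡ᵇ y then just s else just (var y)
substT x s (fn n k xs) with memb x xs | s
... | false | _     = just (fn n k xs)
... | true  | var z = just (fn n k (renameV x z xs))
... | true  | _     = nothing
substT x s (t · u) = M.zipWith _·_ (substT x s t) (substT x s u)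
substT x s (t ⊕ u) = M.zipWith _⊕_ (substT x s t) (substT x s u)
substT x s (! t) = M.map !_ (substT x s t)
substT x s (t ∀ʲ y) =
  if x ≡ᵇ y then just (t ∀ʲ y) else M.map (_∀ʲ y) (substT x s t)

substF : ℕ → Tm → Fm → Maybe Fm
substF x s (atom p) = just (atom p)
substF x s δ = just δ
substF x s ⊥' = just ⊥'
substF x s (~ A) = M.map ~_ (substF x s A)
substF x s (A ⋀ B) = M.zipWith _⋀_ (substF x s A) (substF x s B)
substF x s (A ⋁ B) = M.zipWith _⋁_ (substF x s A) (substF x s B)
substF x s (A ⇒ B) = M.zipWith _⇒_ (substF x s A) (substF x s B)
substF x s (t ∶ A) = M.zipWith _∶_ (substT x s t) (substF x s A)
substF x s (∀' y A) =
  if x ≡ᵇ y then just (∀' y A) else M.map (∀' y) (substF x s A)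
substF x s (∃' y A) =
  if x ≡ᵇ y then just (∃' y A) else M.map (∃' y) (substF x s A)

freeForT : Tm → ℕ → Tm → Bool
freeForT s x (var y) = true
freeForT s x (fn n k xs) = true
freeForT s x (t · u) = freeForT s x t and freeForT s x u
freeForT s x (t ⊕ u) = freeForT s x t and freeForT s x u
freeForT s x (! t) = freeForT s x t
freeForT s x (t ∀ʲ y) =
  not (freeT x (t ∀ʲ y)) or (not (freeT y s) and freeForT s x t)

freeForF : Tm → ℕ → Fm → Bool
freeForF s x (atom p) = true
freeForF s x δ = true
freeForF s x ⊥' = true
freeForF s x (~ A) = freeForF s x A
freeForF s x (A ⋀ B) = freeForF s x A and freeForF s x B
freeForF s x (A ⋁ B) = freeForF s x A and freeForF s x B
freeForF s x (A ⇒ B) = freeForF s x A and freeForF s x B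
freeForF s x (t ∶ A) = freeForT s x t and freeForF s x A
freeForF s x (∀' y A) =
  not (freeF x (∀' y A)) or (not (freeT y s) and freeForF s x A)
freeForF s x (∃' y A) =
  not (freeF x (∃' y A)) or (not (freeT y s) and freeForF s x A)

-- Propositional tautologies: true under every Boolean valuation of the
-- prime formulas (atoms, δ, t:A, (∀x)A, (∃x)A).

eval : (Fm → Bool) → Fm → Bool
eval v ⊥' = false
eval v (~ A) = not (eval v A)
eval v (A ⋀ B) = eval v A and eval v B
eval v (A ⋁ B) = eval v A or eval v B
eval v (A ⇒ B) = not (eval v A) or eval v B
eval v A = v A

Tautology : Fm → Set
Tautology A = (v : Fm → Bool) → T (eval v A)

data Axiom : Fm → Set where
  taut : ∀ {A} → Tautology A → Axiom A
  Q1   : ∀ x A t B → substF x t A ≡ just B → T (freeForF t x A) →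
         Axiom (∀' x A ⇒ B)
  Q2   : ∀ x A B → T (not (freeF x A)) →
         Axiom (∀' x (A ⇒ B) ⇒ (A ⇒ ∀' x B))
  Q3   : ∀ x A t B → substF x t A ≡ just B → T (freeForF t x A) →
         Axiom (B ⇒ ∃' x A)
  Q4   : ∀ x A B → T (not (freeF x B)) →
         Axiom (∀' x (A ⇒ B) ⇒ (∃' x A ⇒ B))
  jK   : ∀ s t A B → Axiom (s ∶ (A ⇒ B) ⇒ (t ∶ A ⇒ (s · t) ∶ B))
  jT   : ∀ t A → Axiom (t ∶ A ⇒ A)
  j4   : ∀ t A → Axiom (t ∶ A ⇒ (! t) ∶ (t ∶ A))
  sumL : ∀ s t A → Axiom (s ∶ A ⇒ (s ⊕ t) ∶ A)
  sumR : ∀ s t A → Axiom (s ∶ A ⇒ (t ⊕ s) ∶ A)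
  UF   : ∀ y x t A → T (not (freeT y t)) → T (not (freeF y A)) →
         Axiom (∃' y (var y ∶ ∀' x (t ∶ A)) ⇒ (t ∀ʲ x) ∶ ∀' x A)

-- Derivability in QLP over the extended language, with extra axioms
-- `Extra`; the flag `AN` says whether Axiom Necessitation is available
-- (AN = false is the subscript-∅ system).

data Deriv (AN : Bool) (Extra : Fm → Set) : Fm → Set where
  ax    : ∀ {A} → Axiom A → Deriv AN Extra A
  extra : ∀ {A} → Extra A → Deriv AN Extra A
  mp    : ∀ {A B} → Deriv AN Extra (A ⇒ B) → Deriv AN Extra A → Deriv AN Extra B
  gen   : ∀ {A} x → Deriv AN Extra A → Deriv AN Extra (∀' x A)
  qNec  : ∀ {A} x → T (not (freeF x A)) → Deriv AN Extra A →
          Deriv AN Extra (∃' x (var x ∶ A))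
  axNec : ∀ {A} → AN ≡ true → Axiom A → ∀ n k (xs : Vec ℕ n) →
          Deriv AN Extra (fn n k xs ∶ A)

QLP∅[_]⊢_ : Fm → Fm → Set
QLP∅[ B ]⊢ A = Deriv false (λ C → C ≡ B) A

δ-axiom : (e₁ e₂ x : ℕ) → Fm
δ-axiom e₁ e₂ x =
  δ ⇔ ((atom e₁ ⋀ ~ ∃' x (var x ∶ (δ ⇒ atom e₁)))
       ⊻ (atom e₂ ⋀ ~ ∃' x (var x ∶ ((δ ⋀ ~ atom e₁) ⇒ atom e₂))))

module Submission where

-- Write φ₁ = E₁ ∧ ¬D₁ and φ₂ = E₂ ∧ ¬D₂, where
-- D₁ = (∃x)x:(δ → E₁) and D₂ = (∃x)x:(δ ∧ ¬E₁ → E₂).  Only the direction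
-- δ → φ₁ ∨ φ₂ of the δ-axiom is needed, and the argument uses nothing but
-- tautological reasoning and the rule qNec (no Axiom Necessitation):
--   1. δ ∧ ¬E₁ → E₂ is a tautological consequence of the axiom
--      (δ ∧ ¬E₁ rules out φ₁, so φ₂ holds); qNec then gives D₂.
--   2. Given D₂, φ₂ is impossible, so δ → E₁ follows; qNec gives D₁.
--   3. Given D₁ and D₂, both φ₁ and φ₂ fail, hence ¬δ.

open import Defs
open import Data.Nat using (ℕ)
open import Data.Bool using (Bool; true; false; T; not)
  renaming (_∧_ to _and_; _∨_ to _or_)
open import Data.Unit using (tt)
open import Data.Empty using (⊥-elim)
open import Data.Product using (_×_; _,_)
open import Data.Sum using (_⊎_; inj₁; inj₂)
open import Data.List using (List; []; _∷_)
open import Data.List.Relation.Unary.All using (All; []; _∷_)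
open import Relation.Nullary using (¬_)
open import Relation.Binary.PropositionalEquality using (refl)

_⊨_ : (Fm → Bool) → Fm → Set
v ⊨ A = T (eval v A)

infix 3 _⊨_

T-and-elim : ∀ {a b} → T (a and b) → T a × T b
T-and-elim {true} {true} _ = tt , tt

T-or-elim : ∀ {a b} → T (a or b) → T a ⊎ T b
T-or-elim {true}  _ = inj₁ tt
T-or-elim {false} t = inj₂ t

T-not-elim : ∀ {a} → T (not a) → ¬ T a
T-not-elim {false} _ ()

T-not-intro : ∀ {a} → ¬ T a → T (not a)
T-not-intro {false} _ = tt
T-not-intro {true}  ¬t = ¬t tt

T-implies-intro : ∀ {a b} → (T a → T b) → T (not a or b)
T-implies-intro {false} _ = tt
T-implies-intro {true}  f = f tt

-- Premises are discharged one at a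
-- time by turning the entailment into an implication and using MP.
tautological-consequence :
  ∀ {AN Extra} (Γ : List Fm) (B : Fm) →
  (∀ v → All (v ⊨_) Γ → v ⊨ B) →
  All (Deriv AN Extra) Γ → Deriv AN Extra B
tautological-consequence [] B entails [] = ax (taut (λ v → entails v []))
tautological-consequence (A ∷ Γ) B entails (⊢A ∷ ⊢Γ) =
  mp (tautological-consequence Γ (A ⇒ B) discharge ⊢Γ) ⊢A
  where
  discharge : ∀ v → All (v ⊨_) Γ → v ⊨ A ⇒ B
  discharge v vΓ = T-implies-intro (λ vA → entails v (vA ∷ vΓ))

module δ-Axiom (e₁ e₂ x : ℕ) where

  E₁ E₂ δ→E₁ δ∧¬E₁→E₂ D₁ D₂ φ₁ φ₂ Ax : Fm
  E₁       = atom e₁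
  E₂       = atom e₂
  δ→E₁     = δ ⇒ E₁
  δ∧¬E₁→E₂ = (δ ⋀ ~ E₁) ⇒ E₂
  D₁       = ∃' x (var x ∶ δ→E₁)
  D₂       = ∃' x (var x ∶ δ∧¬E₁→E₂)
  φ₁       = E₁ ⋀ ~ D₁
  φ₂       = E₂ ⋀ ~ D₂
  Ax       = δ-axiom e₁ e₂ x

  δ-forces-disjunct : ∀ v → v ⊨ Ax → v ⊨ δ → v ⊨ φ₁ ⊎ v ⊨ φ₂
  δ-forces-disjunct v vAx vδ
    with T-and-elim {eval v (δ ⇒ (φ₁ ⊻ φ₂))} vAx
  ... | vδ⇒ , _ with T-or-elim vδ⇒
  ...   | inj₁ v¬δ = ⊥-elim (T-not-elim v¬δ vδ)
  ...   | inj₂ vxor with T-and-elim {eval v (φ₁ ⋁ φ₂)} vxor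
  ...     | v∨ , _ = T-or-elim v∨

  -- Step 1: δ ∧ ¬E₁ → E₂, since δ ∧ ¬E₁ excludes φ₁.
  entails-δ∧¬E₁→E₂ : ∀ v → All (v ⊨_) (Ax ∷ []) → v ⊨ δ∧¬E₁→E₂
  entails-δ∧¬E₁→E₂ v (vAx ∷ []) = T-implies-intro step
    where
    step : v ⊨ δ ⋀ ~ E₁ → v ⊨ E₂
    step vδ∧¬E₁ with T-and-elim {v δ} vδ∧¬E₁
    ... | vδ , v¬E₁ with δ-forces-disjunct v vAx vδ
    ...   | inj₁ vφ₁ with T-and-elim {v E₁} vφ₁
    ...     | vE₁ , _ = ⊥-elim (T-not-elim v¬E₁ vE₁)
    step _ | _ | inj₂ vφ₂ with T-and-elim {v E₂} vφ₂
    ...     | vE₂ , _ = vE₂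

  -- Step 2: with D₂ true, φ₂ is excluded, so δ → E₁.
  entails-δ→E₁ : ∀ v → All (v ⊨_) (Ax ∷ D₂ ∷ []) → v ⊨ δ→E₁
  entails-δ→E₁ v (vAx ∷ vD₂ ∷ []) = T-implies-intro step
    where
    step : v ⊨ δ → v ⊨ E₁
    step vδ with δ-forces-disjunct v vAx vδ
    ... | inj₁ vφ₁ with T-and-elim {v E₁} vφ₁
    ...   | vE₁ , _ = vE₁
    step vδ | inj₂ vφ₂ with T-and-elim {v E₂} vφ₂
    ...   | _ , v¬D₂ = ⊥-elim (T-not-elim v¬D₂ vD₂)

  -- Step 3: with D₁ and D₂ true, both disjuncts are excluded, so ¬δ.
  entails-¬δ : ∀ v → All (v ⊨_) (Ax ∷ D₂ ∷ D₁ ∷ []) → v ⊨ ~ δ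
  entails-¬δ v (vAx ∷ vD₂ ∷ vD₁ ∷ []) = T-not-intro refute
    where
    refute : ¬ (v ⊨ δ)
    refute vδ with δ-forces-disjunct v vAx vδ
    ... | inj₁ vφ₁ with T-and-elim {v E₁} vφ₁
    ...   | _ , v¬D₁ = T-not-elim v¬D₁ vD₁
    refute vδ | inj₂ vφ₂ with T-and-elim {v E₂} vφ₂
    ...   | _ , v¬D₂ = T-not-elim v¬D₂ vD₂

theorem29 : (e₁ e₂ x : ℕ) → QLP∅[ δ-axiom e₁ e₂ x ]⊢ (~ δ)
theorem29 e₁ e₂ x =
  tautological-consequence (Ax ∷ D₂ ∷ D₁ ∷ []) (~ δ) entails-¬δ
    (⊢Ax ∷ ⊢D₂ ∷ ⊢D₁ ∷ [])
  where
  open δ-Axiom e₁ e₂ x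
  ⊢Ax : QLP∅[ Ax ]⊢ Ax
  ⊢Ax = extra refl
  -- qNec applies because δ→E₁ and δ∧¬E₁→E₂ contain no justification
  -- variables, so the side condition "x not free" holds by computation.
  ⊢D₂ : QLP∅[ Ax ]⊢ D₂
  ⊢D₂ = qNec x tt (tautological-consequence (Ax ∷ []) δ∧¬E₁→E₂
                    entails-δ∧¬E₁→E₂
                    (⊢Ax ∷ []))
  ⊢D₁ : QLP∅[ Ax ]⊢ D₁
  ⊢D₁ = qNec x tt (tautological-consequence (Ax ∷ D₂ ∷ []) δ→E₁
                    entails-δ→E₁
                    (⊢Ax ∷ ⊢D₂ ∷ []))
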